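{- Let $G$ be a connected graph with $|V(G)|\ge 3$, and let $H=\boldsymbol{R}(G,T,L,x,\{U_f\}_{f\in E(T)})$ be a rank-expansion of $G$. Let $a,b$ be distinct vertices of $G$ and let $P$ be the path from $L(a)$ to $L(b)$ in $T$. Then $A(H)[\overline{E_I(T)}\cup\{\overline{a},\overline{b}\}]$ is nonsingular if and only if $A(H)[\overline{E(P)}]$ is nonsingular.
   Context: All graphs are finite and simple; $A(G)$ is the adjacency matrix over the binary field $GF(2)$; $M[X,Y]$ is the submatrix with rows $X$, columns $Y$, and $M[X]=M[X,X]$. In a tree $T$, a leaf is a vertex of degree $1$, other vertices are inner; $V_I(T)$ is the set of inner vertices, $E_I(T)$ the set of edges with no leaf as an end, and $\delta(v)$ the set of edges incident with $v$. A tree is subcubic if it has at least two vertices and every inner vertex has degree $3$. A rank-decomposition of $G$ is a pair $(T,L)$ with $T$ subcubic and $L$ a bijection from $V(G)$ to the leaves of $T$. Rank-expansion: let $(T,L)$ be a rank-decomposition of $G$ and $x$ a leaf of $T$; orient every edge of $T$ away from $x$. For $e\in E(T)$ let $T_e$ be the component of $T\setminus e$ not containing $x$, $A_e=L^{ -1}(V(T_e))$, $B_e=V(G)\setminus A_e$, $M_e=A(G)[A_e,B_e]$. Choose sets $U_e\subseteq A_e$ ($e\in E(T)$) such that (i) the rows of $M_e$ indexed by $U_e$ form a basis of the row space of $M_e$, and (ii) $U_e\cap A_f\subseteq U_f$ whenever the head of $e$ is the tail of $f$. Let $P_e$ be the unique $A_e\times U_e$ matrix over $GF(2)$ with $P_eA(G)[U_e,B_e]=A(G)[A_e,B_e]$.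 If the tail of $f$ is the head of $e$, let $C_f=P_e[U_f,U_e]$. The rank-expansion $H=\boldsymbol{R}(G,T,L,x,\{U_f\})$ has vertex set $\bigcup_{v\in V_I(T)}S_v$, where $S_v=\bigcup_{e\in\delta(v)}U_e\times\{e\}\times\{v\}$, and edges: (a) $(a,e,v)(a,e,w)$ for every $e=vw\in E_I(T)$ and $a\in U_e$; (b) $(b,e,v)(a,f,v)$ whenever $v\in V_I(T)$ is the head of $e$ and the tail of $f$, $a\in U_f$, $b\in U_e$ and $(C_f)_{a,b}\ne 0$; (c) $(a,f_1,v)(b,f_2,v)$ whenever $v$ is the tail of two distinct edges $f_1,f_2$, $a\in U_{f_1}$, $b\in U_{f_2}$ and $ab\in E(G)$. For $e=vw\in E_I(T)$ let $\overline{e}=\{(a,e,v),(a,e,w):a\in U_e\}$. For $a\in V(G)$, let $e$ be the unique edge of $T$ incident with the leaf $L(a)$ and $v$ its other end; then $U_e\times\{e\}\times\{v\}$ consists of a single vertex, denoted $\overline{a}$, and we set $\overline{e}=\{\overline{a}\}$. For a set $W$ of edges of $T$, $\overline{W}=\bigcup_{e\in W}\overline{e}$. -}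

module Defs where

open import Data.Nat using (ℕ; zero; suc; _≤_)
open import Data.Nat.Divisibility using (_∣_)
open import Data.Fin using (Fin; _≟_)
open import Data.Bool using (Bool; true; false; _∧_; _∨_; _xor_; not; if_then_else_)
open import Data.List using (List; []; _∷_; length)
open import Data.List.Membership.Propositional using (_∈_)
open import Data.List.Relation.Unary.Unique.Propositional using (Unique)
open import Data.Product using (Σ; ∃; _×_; _,_)
open import Data.Sum using (_⊎_)
open import Relation.Nullary using (¬_)
open import Relation.Nullary.Decidable using (⌊_⌋)
open import Relation.Binary.PropositionalEquality using (_≡_; _≢_)
open import Function.Bundles using (_⇔_)

-- GF(2) = Bool (addition = xor, multiplication = ∧).
-- Finite sums over Fin k.

xorSum : ∀ {k} → (Fin k → Bool) → Bool
xorSum {zero}  f = false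
xorSum {suc k} f = f Fin.zero xor xorSum (λ i → f (Fin.suc i))

countTrue : ∀ {k} → (Fin k → Bool) → ℕ
countTrue {zero}  f = 0
countTrue {suc k} f = (if f Fin.zero then 1 else 0) + countTrue (λ i → f (Fin.suc i))
  where open Data.Nat using (_+_)

record Graph (k : ℕ) : Set where
  field
    adj    : Fin k → Fin k → Bool
    sym    : ∀ u v → adj u v ≡ adj v u
    irrefl : ∀ u → adj u u ≡ false
open Graph public

data WalkL {k : ℕ} (ad : Fin k → Fin k → Bool) : Fin k → Fin k → List (Fin k) → Set where
  single : ∀ {u} → WalkL ad u u (u ∷ [])
  cons   : ∀ {u v w vs} → ad u v ≡ true → WalkL ad v w vs → WalkL ad u w (u ∷ vs)

Reach : ∀ {k} → (Fin k → Fin k → Bool) → Fin k → Fin k → Set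
Reach ad u w = ∃ λ vs → WalkL ad u w vs

Connected : ∀ {k} → Graph k → Set
Connected G = ∀ u v → Reach (adj G) u v

IsPath : ∀ {k} → Graph k → Fin k → Fin k → List (Fin k) → Set
IsPath G u w vs = WalkL (adj G) u w vs × Unique vs

HasCycle : ∀ {k} → Graph k → Set
HasCycle G = Σ _ λ u → Σ _ λ v → Σ (List _) λ vs →
  WalkL (adj G) u v vs × Unique vs × adj G v u ≡ true × 3 ≤ length vs

IsTree : ∀ {k} → Graph k → Set
IsTree T = Connected T × ¬ HasCycle T

data Consec {A : Set} : List A → A → A → Set where
  here  : ∀ {u v vs} → Consec (u ∷ v ∷ vs) u v
  there : ∀ {w u v vs} → Consec vs u v → Consec (w ∷ vs) u v

deg : ∀ {k} → Graph k → Fin k → ℕ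
deg G v = countTrue (adj G v)

Leaf : ∀ {k} → Graph k → Fin k → Set
Leaf T v = deg T v ≡ 1

Inner : ∀ {k} → Graph k → Fin k → Set
Inner T v = ¬ Leaf T v

Subcubic : ∀ {k} → Graph k → Set
Subcubic {k} T = IsTree T × 2 ≤ k × (∀ v → Inner T v → deg T v ≡ 3)

IsRankDecomposition : ∀ {n m} → Graph n → Graph m → (Fin n → Fin m) → Set
IsRankDecomposition {n} {m} G T L =
  Subcubic T × (∀ a → Leaf T (L a)) × (∀ a b → L a ≡ L b → a ≡ b)
  × (∀ ℓ → Leaf T ℓ → ∃ λ a → L a ≡ ℓ)

deleteEdge : ∀ {k} → (Fin k → Fin k → Bool) → Fin k → Fin k → Fin k → Fin k → Bool
deleteEdge ad t h u v =
  ad u v ∧ not ((⌊ u ≟ t ⌋ ∧ ⌊ v ≟ h ⌋) ∨ (⌊ u ≟ h ⌋ ∧ ⌊ v ≟ t ⌋))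

EvenCard : {A : Set} → (A → Set) → Set
EvenCard {A} S = Σ (List A) λ ls → Unique ls × (∀ r → (r ∈ ls) ⇔ S r) × (2 ∣ length ls)

-- Edges of T are represented as ordered pairs (t , h)
-- oriented away from x (t = tail, h = head).  U t h is the set U_e
-- (as a Bool-valued indicator on V(G)), P t h a u is the entry (a , u)
-- of the matrix P_e.

module RankExpansion {n m : ℕ} (G : Graph n) (T : Graph m) (L : Fin n → Fin m)
    (x : Fin m) (U : Fin m → Fin m → Fin n → Bool)
    (P : Fin m → Fin m → Fin n → Fin n → Bool) where

  -- T_e : component of T \ e not containing x
  InTe : Fin m → Fin m → Fin m → Set
  InTe t h w = ¬ Reach (deleteEdge (adj T) t h) x w

  -- (t , h) is an edge of T, oriented away from x (its head h lies in T_e)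
  Arc : Fin m → Fin m → Set
  Arc t h = adj T t h ≡ true × InTe t h h

  -- A_e = L⁻¹(V(T_e)); B_e is its complement
  InA : Fin m → Fin m → Fin n → Set
  InA t h a = InTe t h (L a)

  -- rows of M_e = A(G)[A_e,B_e] indexed by U_e are linearly independent
  RowsIndependent : Fin m → Fin m → Set
  RowsIndependent t h =
    ∀ (λ' : Fin n → Bool) → (∀ u → λ' u ≡ true → U t h u ≡ true) →
    (∀ c → ¬ InA t h c → xorSum (λ u → λ' u ∧ adj G u c) ≡ false) →
    ∀ u → λ' u ≡ false

  -- every row of M_e is a GF(2)-combination of the rows indexed by U_e
  RowsSpan : Fin m → Fin m → Set
  RowsSpan t h =
    ∀ a → InA t h a → Σ (Fin n → Bool) λ λ' → (∀ u → λ' u ≡ true → U t h u ≡ true) ×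
      (∀ c → ¬ InA t h c → adj G a c ≡ xorSum (λ u → λ' u ∧ adj G u c))

  ValidU : Set
  ValidU =
    (∀ t h → Arc t h →
       (∀ a → U t h a ≡ true → InA t h a) × RowsIndependent t h × RowsSpan t h)
    × (∀ t h k → Arc t h → Arc h k → ∀ a → U t h a ≡ true → InA h k a → U h k a ≡ true)

  -- P_e A(G)[U_e,B_e] = A(G)[A_e,B_e]   (this determines P_e on A_e × U_e)
  ValidP : Set
  ValidP = ∀ t h → Arc t h → ∀ a → InA t h a → ∀ c → ¬ InA t h c →
    xorSum (λ u → U t h u ∧ (P t h a u ∧ adj G u c)) ≡ adj G a c

  -- candidate vertices (a , e = (t , h) , v)
  record HV : Set where
    constructor ⟨_,_,_,_⟩
    field
      elt : Fin n
      tl  : Fin m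
      hd  : Fin m
      at  : Fin m
  open HV public

  VH : HV → Set
  VH q = Arc (tl q) (hd q) × (at q ≡ tl q ⊎ at q ≡ hd q) × Inner T (at q)
         × U (tl q) (hd q) (elt q) ≡ true

  AdjA : HV → HV → Set
  AdjA q r = elt q ≡ elt r × tl q ≡ tl r × hd q ≡ hd r × at q ≢ at r
             × Inner T (tl q) × Inner T (hd q)

  -- edges of type (b): q = (b , e , v), r = (a , f , v), v head of e, tail of f,
  -- (C_f)_{a,b} = (P_e)_{a,b} ≠ 0
  AdjB : HV → HV → Set
  AdjB q r = at q ≡ hd q × at r ≡ tl r × at q ≡ at r
             × P (tl q) (hd q) (elt r) (elt q) ≡ true

  AdjC : HV → HV → Set
  AdjC q r = at q ≡ tl q × at r ≡ tl r × at q ≡ at r × hd q ≢ hd r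
             × adj G (elt q) (elt r) ≡ true

  AdjH : HV → HV → Set
  AdjH q r = VH q × VH r × (AdjA q r ⊎ AdjB q r ⊎ AdjB r q ⊎ AdjC q r)

  -- ā : U_e × {e} × {v}, e the edge at the leaf L(a), v its other end
  Bar : Fin n → HV → Set
  Bar a q = Arc (tl q) (hd q) × (tl q ≡ L a ⊎ hd q ≡ L a)
            × (at q ≡ tl q ⊎ at q ≡ hd q) × at q ≢ L a
            × U (tl q) (hd q) (elt q) ≡ true

  EdgeBar : Fin m → Fin m → HV → Set
  EdgeBar t h q =
    (Inner T t × Inner T h × tl q ≡ t × hd q ≡ h × (at q ≡ t ⊎ at q ≡ h)
       × U t h (elt q) ≡ true)
    ⊎ (Σ (Fin n) λ a → (t ≡ L a ⊎ h ≡ L a) × tl q ≡ t × hd q ≡ h × Bar a q)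

  XI : Fin n → Fin n → HV → Set
  XI a b q = (Σ (Fin m) λ t → Σ (Fin m) λ h → Arc t h × Inner T t × Inner T h × EdgeBar t h q)
             ⊎ Bar a q ⊎ Bar b q

  XP : List (Fin m) → HV → Set
  XP ps q = Σ (Fin m) λ t → Σ (Fin m) λ h → Arc t h
            × (Consec ps t h ⊎ Consec ps h t) × EdgeBar t h q

  -- A(H)[X] is nonsingular over GF(2): its kernel is trivial
  Nonsingular : (HV → Set) → Set
  Nonsingular X =
    ∀ (z : HV → Bool) → (∀ q → z q ≡ true → X q) →
    (∀ q → X q → EvenCard (λ r → AdjH q r × z r ≡ true)) →
    ∀ q → z q ≡ false

module Submission where

-- Pendant-pair elimination: if u ∉ X has exactly one neighbour u' ∉ X in X ∪ {u , u'}, then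
-- A[X] and A[X ∪ {u , u'}] are nonsingular together.  Now X_I is X_P plus the pairs of copies
-- (c , e , v), (c , e , w) at the two ends of the inner edges e = vw off the path; call the copy
-- at the end away from s = L(a) far.  A far copy is adjacent in H[X_I] only to its partner and
-- to partners of far copies whose edges have a strictly smaller far side, so the pairs can be
-- peeled off by increasing far side, one pendant-pair elimination at a time.

open import Defs renaming (sym to adj-symmetric)
open import Data.Nat using (ℕ; zero; suc; _≤_; _<_; z≤n; s≤s; _≤?_)
import Data.Nat as ℕ
open import Data.Nat.Properties using (≤-refl; ≤-trans; <-≤-trans; <⇒≤; ≰⇒>; <-irrefl; +-mono-≤; +-mono-≤-<; m≤n+m)
open import Data.Nat.Divisibility using (_∣_; divides; ∣1⇒≡1)
open import Data.Fin using (Fin; _≟_)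
import Data.Fin as Fin
open import Data.Bool using (Bool; true; false; _∧_; _∨_; not; if_then_else_)
import Data.Bool as Bool
open import Data.Bool.Properties using (∨-comm; ∧-comm; ∧-zeroʳ)
open import Data.List using (List; []; _∷_; length; filter; map; cartesianProduct; allFin)
open import Data.List.Properties using (filter-notAll)
open import Data.List.Membership.Propositional using (_∈_)
open import Data.List.Membership.Propositional.Properties
  using (∈-filter⁺; ∈-filter⁻; ∈-map⁺; ∈-cartesianProduct⁺; ∈-allFin)
import Data.List.Membership.DecPropositional as DecMembership
open import Data.List.Relation.Unary.Any using (here; there)
import Data.List.Relation.Unary.Any as Any
open import Data.List.Relation.Unary.All using ([]; _∷_)
import Data.List.Relation.Unary.All as All
open import Data.List.Relation.Unary.All.Properties.Core using (¬Any⇒All¬)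
open import Data.List.Relation.Unary.AllPairs using ([]; _∷_)
open import Data.List.Relation.Unary.Unique.Propositional using (Unique)
import Data.List.Relation.Unary.Unique.Propositional.Properties as Unique
open import Data.Product using (Σ; _×_; _,_; proj₁; proj₂)
open import Data.Sum using (_⊎_; inj₁; inj₂)
import Data.Sum
open import Data.Empty using (⊥; ⊥-elim)
open import Relation.Nullary using (¬_; Dec; yes; no; ¬?)
open import Relation.Nullary.Decidable using (⌊_⌋; isYes≗does; dec-true; dec-false; _×-dec_; _⊎-dec_; toSum)
open import Relation.Unary using (Decidable)
open import Relation.Binary.Definitions using (DecidableEquality)
open import Relation.Binary.PropositionalEquality using (_≡_; _≢_; refl; sym; trans; cong; subst; subst₂)
open import Function using (_∘_)
open import Function.Bundles using (_⇔_; mk⇔; Equivalence)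
open import Function.Construct.Composition using (_⇔-∘_)

open Equivalence using (to; from)

isYes-true : ∀ {A : Set} (a? : Dec A) → A → ⌊ a? ⌋ ≡ true
isYes-true a? a = trans (isYes≗does a?) (dec-true a? a)

isYes-false : ∀ {A : Set} (a? : Dec A) → ¬ A → ⌊ a? ⌋ ≡ false
isYes-false a? ¬a = trans (isYes≗does a?) (dec-false a? ¬a)

isYes-sound : ∀ {A : Set} (a? : Dec A) → ⌊ a? ⌋ ≡ true → A
isYes-sound (yes a) _ = a

true≢false : true ≢ false
true≢false ()

consec-mem : ∀ {A : Set} {vs : List A} {u v} → Consec vs u v → u ∈ vs × v ∈ vs
consec-mem here = here refl , there (here refl)
consec-mem (there c) with consec-mem c
... | u∈ , v∈ = there u∈ , there v∈

consec? : ∀ {k} (vs : List (Fin k)) u v → Dec (Consec vs u v)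
consec? [] u v = no λ ()
consec? (_ ∷ []) u v = no λ { (there ()) }
consec? (w ∷ w' ∷ ws) u v with w ≟ u | w' ≟ v | consec? (w' ∷ ws) u v
... | yes refl | yes refl | _ = yes here
... | _ | _ | yes c = yes (there c)
... | no w≢u | _ | no ¬c = no λ { here → w≢u refl ; (there c) → ¬c c }
... | yes _ | no w'≢v | no ¬c = no λ { here → w'≢v refl ; (there c) → ¬c c }

Adjacency : ℕ → Set
Adjacency k = Fin k → Fin k → Bool

module _ {k : ℕ} {ad : Adjacency k} where

  reach-edge : ∀ {u v} → ad u v ≡ true → Reach ad u v
  reach-edge e = _ , cons e single

  reach-refl : ∀ {u} → Reach ad u u
  reach-refl = _ , single

  reach-trans : ∀ {u v w} → Reach ad u v → Reach ad v w → Reach ad u w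
  reach-trans (_ , single) r = r
  reach-trans (_ , cons e p) r with reach-trans (_ , p) r
  ... | _ , q = _ , cons e q

  reach-sym : (∀ u v → ad u v ≡ ad v u) → ∀ {u v} → Reach ad u v → Reach ad v u
  reach-sym ad-sym (_ , single) = reach-refl
  reach-sym ad-sym (_ , cons {u} {v} e p) =
    reach-trans (reach-sym ad-sym (_ , p)) (reach-edge (trans (ad-sym v u) e))

  walk-reaches : ∀ {s t vs y} → WalkL ad s t vs → y ∈ vs → Reach ad s y
  walk-reaches single (here refl) = reach-refl
  walk-reaches (cons e p) (here refl) = reach-refl
  walk-reaches (cons e p) (there y∈) = reach-trans (reach-edge e) (walk-reaches p y∈)

  path-suffix : ∀ {v w vs u} → WalkL ad v w vs → Unique vs → u ∈ vs →
    Σ (List (Fin k)) λ vs' → WalkL ad u w vs' × Unique vs'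
  path-suffix single uq (here refl) = _ , single , uq
  path-suffix (cons e p) uq (here refl) = _ , cons e p , uq
  path-suffix (cons e p) (_ ∷ uq) (there u∈) = path-suffix p uq u∈

  walk-to-path : ∀ {u w vs} → WalkL ad u w vs → Σ (List (Fin k)) λ vs' → WalkL ad u w vs' × Unique vs'
  walk-to-path single = _ , single , ([] ∷ [])
  walk-to-path {u = u} (cons e p) with walk-to-path p
  ... | vs' , p' , uq with DecMembership._∈?_ _≟_ u vs'
  ... | yes u∈ = path-suffix p' uq u∈
  ... | no u∉ = u ∷ vs' , cons e p' , ¬Any⇒All¬ vs' u∉ ∷ uq

  consec-start : ∀ {s y t vs} → WalkL ad y t vs → Consec (s ∷ vs) s y
  consec-start single = here
  consec-start (cons _ _) = here

  first-edge : ∀ {s t vs} → WalkL ad s t vs → s ≢ t → Σ (Fin k) λ y → Consec vs s y × ad s y ≡ true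
  first-edge single s≢t = ⊥-elim (s≢t refl)
  first-edge (cons e p) _ = _ , consec-start p , e

  last-edge : ∀ {s t vs} → WalkL ad s t vs → s ≢ t → Σ (Fin k) λ y → Consec vs y t × ad y t ≡ true
  last-edge single s≢t = ⊥-elim (s≢t refl)
  last-edge {t = t} (cons {v = y} e p) _ with y ≟ t
  ... | yes refl = _ , consec-start p , e
  ... | no y≢t with last-edge p y≢t
  ... | z , c , e' = z , there c , e'

  path-interior : ∀ {s t vs z} → WalkL ad s t vs → Unique vs → z ∈ vs → z ≢ s → z ≢ t →
    Σ (Fin k) λ p → Σ (Fin k) λ q → p ≢ q × ad p z ≡ true × ad z q ≡ true
  path-interior single _ (here refl) z≢s _ = ⊥-elim (z≢s refl)
  path-interior (cons _ _) _ (here refl) z≢s _ = ⊥-elim (z≢s refl)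
  path-interior {z = z} (cons {v = y} e p) (s∉ ∷ uq) (there z∈) _ z≢t with z ≟ y
  ... | no z≢y = path-interior p uq z∈ z≢y z≢t
  ... | yes refl with first-edge p z≢t
  ... | q , c , e' = _ , q , (λ s≡q → All.lookup s∉ (proj₂ (consec-mem c)) s≡q) , e , e'

module _ {k : ℕ} {ad ad' : Adjacency k} where

  walk-mono : (∀ u v → ad u v ≡ true → ad' u v ≡ true) → ∀ {u w vs} → WalkL ad u w vs → WalkL ad' u w vs
  walk-mono incl single = single
  walk-mono incl (cons e p) = cons (incl _ _ e) (walk-mono incl p)

  reach-mono : (∀ u v → ad u v ≡ true → ad' u v ≡ true) → ∀ {u w} → Reach ad u w → Reach ad' u w
  reach-mono incl (_ , p) = _ , walk-mono incl p

  reach-ext : (∀ u v → ad u v ≡ ad' u v) → ∀ {u w} → Reach ad u w → Reach ad' u w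
  reach-ext eq = reach-mono (λ u v e → trans (sym (eq u v)) e)

pair-test-false : ∀ {k} {u t v h : Fin k} → (u ≡ t → v ≢ h) → ⌊ u ≟ t ⌋ ∧ ⌊ v ≟ h ⌋ ≡ false
pair-test-false {u = u} {t} {v} {h} ne with u ≟ t
... | no _ = refl
... | yes u≡t = isYes-false (v ≟ h) (ne u≡t)

module _ {k : ℕ} where

  cut-sub : ∀ (ad : Adjacency k) t h u v → deleteEdge ad t h u v ≡ true → ad u v ≡ true
  cut-sub ad t h u v e with ad u v
  ... | true = refl
  ... | false = e

  cut-keeps : ∀ {ad : Adjacency k} {t h u v} → ad u v ≡ true → (u ≡ t → v ≢ h) → (u ≡ h → v ≢ t) →
    deleteEdge ad t h u v ≡ true
  cut-keeps e th ht rewrite e | pair-test-false th | pair-test-false ht = refl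

  cut-keeps-off : ∀ {ad : Adjacency k} {t h u v} → ad u v ≡ true → u ≢ t → u ≢ h → deleteEdge ad t h u v ≡ true
  cut-keeps-off {ad} e u≢t u≢h = cut-keeps {ad = ad} e (λ u≡t _ → u≢t u≡t) (λ u≡h _ → u≢h u≡h)

  cut-removes : ∀ (ad : Adjacency k) t h → deleteEdge ad t h t h ≡ false
  cut-removes ad t h rewrite isYes-true (t ≟ t) refl | isYes-true (h ≟ h) refl = ∧-zeroʳ _

  cut-swap : ∀ (ad : Adjacency k) t h u v → deleteEdge ad t h u v ≡ deleteEdge ad h t u v
  cut-swap ad t h u v = cong (λ b → ad u v ∧ not b) (∨-comm (⌊ u ≟ t ⌋ ∧ ⌊ v ≟ h ⌋) (⌊ u ≟ h ⌋ ∧ ⌊ v ≟ t ⌋))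

  cut-symmetric : ∀ (ad : Adjacency k) → (∀ u v → ad u v ≡ ad v u) → ∀ t h u v →
    deleteEdge ad t h u v ≡ deleteEdge ad t h v u
  cut-symmetric ad ad-sym t h u v
    rewrite ad-sym u v | ∧-comm ⌊ u ≟ t ⌋ ⌊ v ≟ h ⌋ | ∧-comm ⌊ u ≟ h ⌋ ⌊ v ≟ t ⌋ =
    cong (λ b → ad v u ∧ not b) (∨-comm (⌊ v ≟ h ⌋ ∧ ⌊ u ≟ t ⌋) (⌊ v ≟ t ⌋ ∧ ⌊ u ≟ h ⌋))

  cut-nonedge : ∀ {ad : Adjacency k} {t h} → ad t h ≡ false → ad h t ≡ false → ∀ u v →
    deleteEdge ad t h u v ≡ ad u v
  cut-nonedge {ad} {t} {h} th ht u v = by-value (ad u v) refl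
    where
    by-value : ∀ b → ad u v ≡ b → deleteEdge ad t h u v ≡ ad u v
    by-value false e rewrite e = refl
    by-value true e = trans (cut-keeps {ad = ad} e (λ { refl refl → true≢false (trans (sym e) th) })
                                                   (λ { refl refl → true≢false (trans (sym e) ht) })) (sym e)

  cut-mono : ∀ {ad ad' : Adjacency k} → (∀ u v → ad u v ≡ true → ad' u v ≡ true) → ∀ t h u v →
    deleteEdge ad t h u v ≡ true → deleteEdge ad' t h u v ≡ true
  cut-mono {ad} incl t h u v e with ad u v in eq
  ... | true rewrite incl u v eq = e

  walk-until-cut : ∀ {ad : Adjacency k} a b {s t vs} → WalkL ad s t vs →
    WalkL (deleteEdge ad a b) s t vs ⊎ Reach (deleteEdge ad a b) s a ⊎ Reach (deleteEdge ad a b) s b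
  walk-until-cut a b single = inj₁ single
  walk-until-cut {ad} a b (cons {u} e p) with u ≟ a | u ≟ b
  ... | yes refl | _ = inj₂ (inj₁ reach-refl)
  ... | no _ | yes refl = inj₂ (inj₂ reach-refl)
  ... | no u≢a | no u≢b with walk-until-cut a b p | cut-keeps-off {ad = ad} e u≢a u≢b
  ... | inj₁ w | kept = inj₁ (cons kept w)
  ... | inj₂ (inj₁ r) | kept = inj₂ (inj₁ (reach-trans (reach-edge kept) r))
  ... | inj₂ (inj₂ r) | kept = inj₂ (inj₂ (reach-trans (reach-edge kept) r))

  walk-avoiding : ∀ {ad : Adjacency k} a b {s t vs} → WalkL ad s t vs →
    ¬ Consec vs a b → ¬ Consec vs b a → WalkL (deleteEdge ad a b) s t vs
  walk-avoiding a b single _ _ = single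
  walk-avoiding {ad} a b (cons e p) ¬ab ¬ba =
    cons (cut-keeps {ad = ad} e (λ { refl refl → ¬ab (consec-start p) }) (λ { refl refl → ¬ba (consec-start p) }))
         (walk-avoiding a b p (¬ab ∘ there) (¬ba ∘ there))

indicator : Bool → ℕ
indicator b = if b then 1 else 0

indicator-mono : ∀ {b c} → (b ≡ true → c ≡ true) → indicator b ≤ indicator c
indicator-mono {false} _ = z≤n
indicator-mono {true} incl rewrite incl refl = ≤-refl

count-mono : ∀ {k} (f g : Fin k → Bool) → (∀ i → f i ≡ true → g i ≡ true) → countTrue f ≤ countTrue g
count-mono {zero} f g incl = z≤n
count-mono {suc k} f g incl = +-mono-≤ (indicator-mono (incl Fin.zero)) (count-mono (f ∘ Fin.suc) (g ∘ Fin.suc) (incl ∘ Fin.suc))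

count-strict : ∀ {k} (f g : Fin k → Bool) → (∀ i → f i ≡ true → g i ≡ true) →
  ∀ j → f j ≡ false → g j ≡ true → countTrue f < countTrue g
count-strict {suc k} f g incl Fin.zero fj gj rewrite fj | gj =
  s≤s (count-mono (f ∘ Fin.suc) (g ∘ Fin.suc) (incl ∘ Fin.suc))
count-strict {suc k} f g incl (Fin.suc j) fj gj =
  +-mono-≤-< (indicator-mono (incl Fin.zero)) (count-strict (f ∘ Fin.suc) (g ∘ Fin.suc) (incl ∘ Fin.suc) j fj gj)

count-positive : ∀ {k} (f : Fin k → Bool) i → f i ≡ true → 1 ≤ countTrue f
count-positive f Fin.zero fi rewrite fi = s≤s z≤n
count-positive f (Fin.suc i) fi = ≤-trans (count-positive (f ∘ Fin.suc) i fi) (m≤n+m _ (indicator (f Fin.zero)))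

count-two : ∀ {k} (f : Fin k → Bool) i j → f i ≡ true → f j ≡ true → i ≢ j → 2 ≤ countTrue f
count-two f Fin.zero Fin.zero _ _ i≢j = ⊥-elim (i≢j refl)
count-two f Fin.zero (Fin.suc j) fi fj _ rewrite fi = s≤s (count-positive (f ∘ Fin.suc) j fj)
count-two f (Fin.suc i) Fin.zero fi fj _ rewrite fj = s≤s (count-positive (f ∘ Fin.suc) i fi)
count-two f (Fin.suc i) (Fin.suc j) fi fj i≢j =
  ≤-trans (count-two (f ∘ Fin.suc) i j fi fj (i≢j ∘ cong Fin.suc)) (m≤n+m _ (indicator (f Fin.zero)))

leaf-neighbour-unique : ∀ {k} (T : Graph k) {ℓ} → Leaf T ℓ → ∀ {p q} → adj T ℓ p ≡ true → adj T ℓ q ≡ true → p ≡ q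
leaf-neighbour-unique T {ℓ} leaf {p} {q} ep eq with p ≟ q
... | yes p≡q = p≡q
... | no p≢q with subst (2 ≤_) leaf (count-two (adj T ℓ) p q ep eq p≢q)
... | s≤s ()

adjacent-distinct : ∀ {k} (G : Graph k) {u v} → adj G u v ≡ true → u ≢ v
adjacent-distinct G {u} e refl with trans (sym e) (irrefl G u)
... | ()

-- In a graph without cycles every edge is a bridge: after deleting it, its ends are
-- disconnected (a path between them would close a cycle of length at least 3).
edge-is-bridge : ∀ {k} (T : Graph k) → ¬ HasCycle T → ∀ {t h} → adj T t h ≡ true →
  ¬ Reach (deleteEdge (adj T) t h) t h
edge-is-bridge T acyclic {t} {h} e (_ , walk) with walk-to-path walk
... | vs , path , unique =
  acyclic (t , h , vs , walk-mono (cut-sub (adj T) t h) path , unique , trans (adj-symmetric T h t) e , long path)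
  where
  long : ∀ {vs} → WalkL (deleteEdge (adj T) t h) t h vs → 3 ≤ length vs
  long single = ⊥-elim (true≢false (trans (sym e) (irrefl T t)))
  long (cons d single) = ⊥-elim (true≢false (trans (sym d) (cut-removes (adj T) t h)))
  long (cons _ (cons _ single)) = s≤s (s≤s (s≤s z≤n))
  long (cons _ (cons _ (cons _ _))) = s≤s (s≤s (s≤s z≤n))

module TreeSides {k : ℕ} (T : Graph k) (connected : Connected T) (acyclic : ¬ HasCycle T) where

  cut : Fin k → Fin k → Adjacency k
  cut = deleteEdge (adj T)

  cut-sym : ∀ t h u v → cut t h u v ≡ cut t h v u
  cut-sym = cut-symmetric (adj T) (adj-symmetric T)

  side : ∀ t h z → Reach (cut t h) z t ⊎ Reach (cut t h) z h
  side t h z with walk-until-cut t h (proj₂ (connected z t))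
  ... | inj₁ w = inj₁ (_ , w)
  ... | inj₂ r = r

  sides-disjoint : ∀ {t h z} → adj T t h ≡ true → Reach (cut t h) z t → Reach (cut t h) z h → ⊥
  sides-disjoint e zt zh = edge-is-bridge T acyclic e (reach-trans (reach-sym (cut-sym _ _) zt) zh)

  same-side? : ∀ t h z w → Dec (Reach (cut t h) z w)
  same-side? t h z w with adj T t h in e
  ... | false = yes (reach-ext (λ u v → sym (cut-nonedge e (trans (adj-symmetric T h t) e) u v)) (connected z w))
  ... | true with side t h z | side t h w
  ... | inj₁ zt | inj₁ wt = yes (reach-trans zt (reach-sym (cut-sym _ _) wt))
  ... | inj₂ zh | inj₂ wh = yes (reach-trans zh (reach-sym (cut-sym _ _) wh))
  ... | inj₁ zt | inj₂ wh = no λ zw → sides-disjoint e zt (reach-trans zw wh)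
  ... | inj₂ zh | inj₁ wt = no λ zw → sides-disjoint e (reach-trans zw wt) zh

  orientation-unique : ∀ r t h → ¬ Reach (cut t h) r h → ¬ Reach (cut h t) r t → ⊥
  orientation-unique r t h ¬rh ¬rt with side t h r
  ... | inj₁ rt = ¬rt (reach-ext (cut-swap (adj T) t h) rt)
  ... | inj₂ rh = ¬rh rh

  -- Seen from a fixed vertex s, the far side of an edge is the set of vertices s cannot
  -- reach once the edge is deleted; it shrinks strictly as we walk away from s.
  module FarSides (s : Fin k) where

    farSize : Fin k → Fin k → ℕ
    farSize t h = countTrue (λ z → ⌊ ¬? (same-side? t h s z) ⌋)

    step-away : ∀ {v w y} → adj T v w ≡ true → adj T w y ≡ true → y ≢ v → ¬ Reach (cut v w) s w →
      Reach (cut w y) s w × (∀ {z} → Reach (cut v w) s z → Reach (cut w y) s z)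
    step-away {v} {w} {y} vw wy y≢v w-far = reach-trans (keep s-near-v) (reach-edge vw-kept) , keep
      where
      vw-kept : cut w y v w ≡ true
      vw-kept = cut-keeps {ad = adj T} vw (λ v≡w _ → adjacent-distinct T vw v≡w) (λ v≡y _ → y≢v (sym v≡y))
      s-near-v : Reach (cut v w) s v
      s-near-v with side v w s
      ... | inj₁ r = r
      ... | inj₂ r = ⊥-elim (w-far r)
      keep : ∀ {z} → Reach (cut v w) s z → Reach (cut w y) s z
      keep (_ , walk) with walk-until-cut w y walk
      ... | inj₁ walk' = _ , walk-mono (cut-mono (cut-sub (adj T) v w) w y) walk'
      ... | inj₂ (inj₁ r) = ⊥-elim (w-far (reach-mono (cut-sub (cut v w) w y) r))
      ... | inj₂ (inj₂ r) = ⊥-elim (w-far (reach-trans (reach-mono (cut-sub (cut v w) w y) r) (reach-edge yw-kept)))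
        where
        yw-kept : cut v w y w ≡ true
        yw-kept = cut-keeps {ad = adj T} (trans (adj-symmetric T y w) wy) (λ y≡v _ → y≢v y≡v)
                                                                          (λ y≡w _ → adjacent-distinct T wy (sym y≡w))

    far-shrinks : ∀ {v w y} → adj T v w ≡ true → adj T w y ≡ true → y ≢ v → ¬ Reach (cut v w) s w →
      farSize w y < farSize v w
    far-shrinks {v} {w} {y} vw wy y≢v w-far =
      count-strict _ _ inclusion w (isYes-false (¬? (same-side? w y s w)) λ ¬r → ¬r w-near)
                                   (isYes-true (¬? (same-side? v w s w)) w-far)
      where
      w-near = proj₁ (step-away vw wy y≢v w-far)
      inclusion : ∀ z → ⌊ ¬? (same-side? w y s z) ⌋ ≡ true → ⌊ ¬? (same-side? v w s z) ⌋ ≡ true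
      inclusion z far = isYes-true (¬? (same-side? v w s z))
        (λ near → isYes-sound (¬? (same-side? w y s z)) far (proj₂ (step-away vw wy y≢v w-far) near))

parity : ∀ n → 2 ∣ n ⊎ 2 ∣ suc n
parity zero = inj₁ (divides 0 refl)
parity (suc n) with parity n
... | inj₁ 2∣n = inj₂ (divides (suc (_∣_.quotient 2∣n)) (cong (suc ∘ suc) (_∣_.equality 2∣n)))
... | inj₂ 2∣1+n = inj₁ 2∣1+n

module _ {A : Set} where

  evenCard-resp : {S S' : A → Set} → (∀ r → S r → S' r) → (∀ r → S' r → S r) → EvenCard S → EvenCard S'
  evenCard-resp f g (ls , uq , mem , ev) = ls , uq , (λ r → mk⇔ (f r ∘ to (mem r)) (from (mem r) ∘ g r)) , ev

  evenCard-empty : {S : A → Set} → (∀ r → ¬ S r) → EvenCard S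
  evenCard-empty empty = [] , [] , (λ r → mk⇔ (λ ()) (⊥-elim ∘ empty r)) , divides 0 refl

  singleton-odd : {S : A → Set} (u : A) → (∀ r → S r → r ≡ u) → S u → ¬ EvenCard S
  singleton-odd u only su ([] , _ , mem , _) with () ← from (mem u) su
  singleton-odd u only su (_ ∷ [] , _ , _ , 2∣1) with () ← ∣1⇒≡1 2∣1
  singleton-odd u only su (r ∷ r' ∷ _ , (r∉ ∷ _) , mem , _) =
    All.lookup r∉ (here refl) (trans (only r (to (mem r) (here refl))) (sym (only r' (to (mem r') (there (here refl))))))

module FiniteParity {A : Set} (enum : List A) (enum-unique : Unique enum) (enum-complete : ∀ a → a ∈ enum)
    {S : A → Set} (S? : Decidable S) where

  members : List A
  members = filter S? enum

  members-unique : Unique members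
  members-unique = Unique.filter⁺ S? enum-unique

  member-sound : ∀ {r} → r ∈ members → S r
  member-sound r∈ = proj₂ (∈-filter⁻ S? {xs = enum} r∈)

  member-complete : ∀ r → S r → r ∈ members
  member-complete r Sr = ∈-filter⁺ S? (enum-complete r) Sr

  evenCard-or-add : ∀ u → ¬ S u → EvenCard S ⊎ EvenCard (λ r → S r ⊎ r ≡ u)
  evenCard-or-add u ¬Su with parity (length members)
  ... | inj₁ even = inj₁ (members , members-unique , (λ r → mk⇔ member-sound (member-complete r)) , even)
  ... | inj₂ odd = inj₂ (u ∷ members , ¬Any⇒All¬ members (¬Su ∘ member-sound) ∷ members-unique ,
                         (λ r → mk⇔ added-sound (added-complete r)) , odd)
    where
    added-sound : ∀ {r} → r ∈ u ∷ members → S r ⊎ r ≡ u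
    added-sound (here refl) = inj₂ refl
    added-sound (there r∈) = inj₁ (member-sound r∈)
    added-complete : ∀ r → S r ⊎ r ≡ u → r ∈ u ∷ members
    added-complete r (inj₁ Sr) = there (member-complete r Sr)
    added-complete r (inj₂ refl) = here refl

-- Nonsingularity over GF(2) of principal submatrices A[X] of the adjacency matrix of a finite
-- graph (V , Adj), read as: the only 0/1-vector z supported on X with an even number of
-- z-neighbours at every vertex of X (A[X] z = 0) is z = 0.
module KernelGraph {V : Set} (_≟V_ : DecidableEquality V) (enum : List V) (enum-unique : Unique enum)
    (enum-complete : ∀ v → v ∈ enum) (Adj : V → V → Set) (Adj? : ∀ q r → Dec (Adj q r))
    (Adj-sym : ∀ {q r} → Adj q r → Adj r q) where

  Row : (V → Bool) → V → V → Set
  Row z q r = Adj q r × z r ≡ true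

  Supported : (V → Set) → (V → Bool) → Set
  Supported X z = ∀ q → z q ≡ true → X q

  Balanced : (V → Set) → (V → Bool) → Set
  Balanced X z = ∀ q → X q → EvenCard (Row z q)

  Nonsing : (V → Set) → Set
  Nonsing X = ∀ z → Supported X z → Balanced X z → ∀ q → z q ≡ false

  nonsing-resp : {X Y : V → Set} → (∀ r → X r → Y r) → (∀ r → Y r → X r) → Nonsing X → Nonsing Y
  nonsing-resp X⊆Y Y⊆X ns z supp bal = ns z (λ q → Y⊆X q ∘ supp q) (λ q → bal q ∘ X⊆Y q)

  With : (V → Set) → V → V → V → Set
  With X u u' r = X r ⊎ r ≡ u ⊎ r ≡ u'

  _[_≔_] : (V → Bool) → V → Bool → V → Bool
  (z [ u ≔ b ]) q with q ≟V u
  ... | yes _ = b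
  ... | no _ = z q

  update-at : ∀ z u b → (z [ u ≔ b ]) u ≡ b
  update-at z u b with u ≟V u
  ... | yes _ = refl
  ... | no u≢u = ⊥-elim (u≢u refl)

  update-off : ∀ z u b {q} → q ≢ u → (z [ u ≔ b ]) q ≡ z q
  update-off z u b {q} q≢u with q ≟V u
  ... | yes q≡u = ⊥-elim (q≢u q≡u)
  ... | no _ = refl

  update-same : ∀ z u {b} → z u ≡ b → ∀ q → (z [ u ≔ b ]) q ≡ z q
  update-same z u zu q with toSum (q ≟V u)
  ... | inj₁ refl = trans (update-at z u _) (sym zu)
  ... | inj₂ q≢u = update-off z u _ q≢u

  row-ext : ∀ {z z' q} → (∀ r → z r ≡ z' r) → EvenCard (Row z q) → EvenCard (Row z' q)
  row-ext z≗z' = evenCard-resp (λ r (qr , zr) → qr , trans (sym (z≗z' r)) zr) (λ r (qr , zr) → qr , trans (z≗z' r) zr)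

  row-update : ∀ {z u b q} → ¬ Adj q u → EvenCard (Row z q) → EvenCard (Row (z [ u ≔ b ]) q)
  row-update {z} {u} {b} {q} ¬qu = evenCard-resp forward backward
    where
    forward : ∀ r → Row z q r → Row (z [ u ≔ b ]) q r
    forward r (qr , zr) with toSum (r ≟V u)
    ... | inj₁ refl = ⊥-elim (¬qu qr)
    ... | inj₂ r≢u = qr , trans (update-off z u b r≢u) zr
    backward : ∀ r → Row (z [ u ≔ b ]) q r → Row z q r
    backward r (qr , zr) with toSum (r ≟V u)
    ... | inj₁ refl = ⊥-elim (¬qu qr)
    ... | inj₂ r≢u = qr , trans (sym (update-off z u b r≢u)) zr

  module PendantPair (X : V → Set) (u u' : V) (u∉X : ¬ X u) (u'∉X : ¬ X u') (u≢u' : u ≢ u')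
      (uu' : Adj u u') (pendant : ∀ r → With X u u' r → Adj u r → r ≡ u') where

    X-misses-u : ∀ q → X q → ¬ Adj q u
    X-misses-u q Xq qu with pendant q (inj₁ Xq) (Adj-sym qu)
    ... | refl = u'∉X Xq

    module FromSmaller (ns : Nonsing X) (z : V → Bool) (supp : Supported (With X u u') z)
        (bal : Balanced (With X u u') z) where

      -- row u contains at most the entry u'
      partner-zero : z u' ≡ false
      partner-zero with z u' in zu'
      ... | false = refl
      ... | true = ⊥-elim (singleton-odd u' (λ r row → pendant r (supp r (proj₂ row)) (proj₁ row))
                                             (uu' , zu') (bal u (inj₂ (inj₁ refl))))

      cleared : V → Bool
      cleared = z [ u ≔ false ]

      cleared-zero : ∀ q → cleared q ≡ false
      cleared-zero = ns cleared supported balanced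
        where
        supported : Supported X cleared
        supported q zq with toSum (q ≟V u)
        ... | inj₁ refl = ⊥-elim (true≢false (trans (sym zq) (update-at z u false)))
        ... | inj₂ q≢u with supp q (trans (sym (update-off z u false q≢u)) zq)
        ... | inj₁ Xq = Xq
        ... | inj₂ (inj₁ q≡u) = ⊥-elim (q≢u q≡u)
        ... | inj₂ (inj₂ refl) = ⊥-elim (true≢false (trans (sym zq) (trans (update-off z u false q≢u) partner-zero)))
        balanced : Balanced X cleared
        balanced q Xq = row-update (X-misses-u q Xq) (bal q (inj₁ Xq))

      -- row u' then contains at most the entry u
      pendant-zero : z u ≡ false
      pendant-zero with z u in zu
      ... | false = refl
      ... | true = ⊥-elim (singleton-odd u only-u (Adj-sym uu' , zu) (bal u' (inj₂ (inj₂ refl))))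
        where
        only-u : ∀ r → Row z u' r → r ≡ u
        only-u r (_ , zr) with toSum (r ≟V u)
        ... | inj₁ r≡u = r≡u
        ... | inj₂ r≢u = ⊥-elim (true≢false (trans (sym zr) (trans (sym (update-off z u false r≢u)) (cleared-zero r))))

      vanishes : ∀ q → z q ≡ false
      vanishes q with toSum (q ≟V u)
      ... | inj₁ refl = pendant-zero
      ... | inj₂ q≢u = trans (sym (update-off z u false q≢u)) (cleared-zero q)

    module FromLarger (ns : Nonsing (With X u u')) (z : V → Bool) (supp : Supported X z)
        (bal : Balanced X z) where

      off-X : ∀ {r} → ¬ X r → z r ≡ false
      off-X {r} ¬Xr with z r in zr
      ... | false = refl
      ... | true = ⊥-elim (¬Xr (supp r zr))

      -- setting the entry at u to any value that balances row u' gives a kernel vector of the larger matrix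
      extension-zero : ∀ p → EvenCard (Row (z [ u ≔ p ]) u') → ∀ q → z q ≡ false
      extension-zero p row-u' q with toSum (q ≟V u)
      ... | inj₁ refl = off-X u∉X
      ... | inj₂ q≢u = trans (sym (update-off z u p q≢u)) (ns (z [ u ≔ p ]) supported balanced q)
        where
        supported : Supported (With X u u') (z [ u ≔ p ])
        supported r zr with toSum (r ≟V u)
        ... | inj₁ r≡u = inj₂ (inj₁ r≡u)
        ... | inj₂ r≢u = inj₁ (supp r (trans (sym (update-off z u p r≢u)) zr))
        balanced : Balanced (With X u u') (z [ u ≔ p ])
        balanced r (inj₁ Xr) = row-update (X-misses-u r Xr) (bal r Xr)
        balanced r (inj₂ (inj₂ refl)) = row-u'
        balanced r (inj₂ (inj₁ refl)) = evenCard-empty empty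
          where
          empty : ∀ s → ¬ Row (z [ u ≔ p ]) u s
          empty s (us , zs) with pendant s (supported s zs) us
          ... | refl = true≢false (trans (sym zs) (trans (update-off z u p (u≢u' ∘ sym)) (off-X u'∉X)))

      -- such a value exists: 0 if row u' is already balanced, 1 otherwise
      vanishes : ∀ q → z q ≡ false
      vanishes with FiniteParity.evenCard-or-add enum enum-unique enum-complete
                      (λ r → Adj? u' r ×-dec (z r Bool.≟ true)) u (λ row → true≢false (trans (sym (proj₂ row)) (off-X u∉X)))
      ... | inj₁ even = extension-zero false (row-ext (λ r → sym (update-same z u (off-X u∉X) r)) even)
      ... | inj₂ odd = extension-zero true (evenCard-resp (λ r → add r) (λ r → unadd r) odd)
        where
        add : ∀ r → Row z u' r ⊎ r ≡ u → Row (z [ u ≔ true ]) u' r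
        add r (inj₂ refl) = Adj-sym uu' , update-at z u true
        add r (inj₁ (ur , zr)) with toSum (r ≟V u)
        ... | inj₁ refl = ⊥-elim (true≢false (trans (sym zr) (off-X u∉X)))
        ... | inj₂ r≢u = ur , trans (update-off z u true r≢u) zr
        unadd : ∀ r → Row (z [ u ≔ true ]) u' r → Row z u' r ⊎ r ≡ u
        unadd r (ur , zr) with toSum (r ≟V u)
        ... | inj₁ r≡u = inj₂ r≡u
        ... | inj₂ r≢u = inj₁ (ur , trans (sym (update-off z u true r≢u)) zr)

    pendant-pair : Nonsing X ⇔ Nonsing (With X u u')
    pendant-pair = mk⇔ (λ ns z supp bal → FromSmaller.vanishes ns z supp bal)
                       (λ ns z supp bal → FromLarger.vanishes ns z supp bal)

  -- Peeling: X extended by the pairs {u , π u} for u in a list fs.  If the pairs can be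
  -- ordered (by a key) so that each u is pendant once the pairs of smaller key are gone,
  -- removing them one at a time with the pendant-pair lemma preserves nonsingularity.
  module Peeling (X : V → Set) (π : V → V) (key : V → ℕ) where

    Extended : List V → V → Set
    Extended fs r = X r ⊎ Σ V λ u → u ∈ fs × (r ≡ u ⊎ r ≡ π u)

    record Peelable (fs : List V) : Set where
      field
        outside           : ∀ u → u ∈ fs → ¬ X u
        partner-outside   : ∀ u → u ∈ fs → ¬ X (π u)
        not-partner       : ∀ u u₂ → u ∈ fs → u₂ ∈ fs → u ≢ π u₂
        partner-injective : ∀ u u₂ → u ∈ fs → u₂ ∈ fs → π u ≡ π u₂ → u ≡ u₂
        partner-adjacent  : ∀ u → u ∈ fs → Adj u (π u)
        neighbours        : ∀ u → u ∈ fs → ∀ r → Extended fs r → Adj u r →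
                            r ≡ π u ⊎ Σ V λ u₂ → u₂ ∈ fs × r ≡ π u₂ × key u₂ < key u

    min-by-key : ∀ f fs → Σ V λ u → u ∈ f ∷ fs × (∀ v → v ∈ f ∷ fs → key u ≤ key v)
    min-by-key f [] = f , here refl , λ { v (here refl) → ≤-refl }
    min-by-key f (g ∷ gs) with min-by-key g gs
    ... | m , m∈ , m-min with key f ≤? key m
    ... | yes f≤m = f , here refl , λ { v (here refl) → ≤-refl ; v (there v∈) → ≤-trans f≤m (m-min v v∈) }
    ... | no f≰m = m , there m∈ , λ { v (here refl) → <⇒≤ (≰⇒> f≰m) ; v (there v∈) → m-min v v∈ }

    module RemoveMinimal {fs : List V} (peelable : Peelable fs) (u₀ : V) (u₀∈ : u₀ ∈ fs)
        (minimal : ∀ v → v ∈ fs → key u₀ ≤ key v) where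

      open Peelable peelable

      rest : List V
      rest = filter (λ v → ¬? (v ≟V u₀)) fs

      rest-sub : ∀ {v} → v ∈ rest → v ∈ fs
      rest-sub v∈ = proj₁ (∈-filter⁻ (λ v → ¬? (v ≟V u₀)) {xs = fs} v∈)

      rest-≢ : ∀ {v} → v ∈ rest → v ≢ u₀
      rest-≢ v∈ = proj₂ (∈-filter⁻ (λ v → ¬? (v ≟V u₀)) {xs = fs} v∈)

      rest-intro : ∀ {v} → v ∈ fs → v ≢ u₀ → v ∈ rest
      rest-intro v∈ v≢u₀ = ∈-filter⁺ (λ v → ¬? (v ≟V u₀)) v∈ v≢u₀

      rest-shorter : length rest < length fs
      rest-shorter = filter-notAll (λ v → ¬? (v ≟V u₀)) fs (Any.map (λ { refl ¬refl → ¬refl refl }) u₀∈)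

      extended-sub : ∀ r → Extended rest r → Extended fs r
      extended-sub r (inj₁ Xr) = inj₁ Xr
      extended-sub r (inj₂ (u , u∈ , e)) = inj₂ (u , rest-sub u∈ , e)

      split : ∀ r → Extended fs r → With (Extended rest) u₀ (π u₀) r
      split r (inj₁ Xr) = inj₁ (inj₁ Xr)
      split r (inj₂ (u , u∈ , e)) with toSum (u ≟V u₀)
      split r (inj₂ (u , u∈ , inj₁ r≡u)) | inj₁ refl = inj₂ (inj₁ r≡u)
      split r (inj₂ (u , u∈ , inj₂ r≡πu)) | inj₁ refl = inj₂ (inj₂ r≡πu)
      ... | inj₂ u≢u₀ = inj₁ (inj₂ (u , rest-intro u∈ u≢u₀ , e))

      merge : ∀ r → With (Extended rest) u₀ (π u₀) r → Extended fs r
      merge r (inj₁ Er) = extended-sub r Er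
      merge r (inj₂ (inj₁ r≡u₀)) = inj₂ (u₀ , u₀∈ , inj₁ r≡u₀)
      merge r (inj₂ (inj₂ r≡πu₀)) = inj₂ (u₀ , u₀∈ , inj₂ r≡πu₀)

      u₀-outside : ¬ Extended rest u₀
      u₀-outside (inj₁ Xu₀) = outside u₀ u₀∈ Xu₀
      u₀-outside (inj₂ (u , u∈ , inj₁ u₀≡u)) = rest-≢ u∈ (sym u₀≡u)
      u₀-outside (inj₂ (u , u∈ , inj₂ u₀≡πu)) = not-partner u₀ u u₀∈ (rest-sub u∈) u₀≡πu

      partner-outside-rest : ¬ Extended rest (π u₀)
      partner-outside-rest (inj₁ Xπu₀) = partner-outside u₀ u₀∈ Xπu₀
      partner-outside-rest (inj₂ (u , u∈ , inj₁ πu₀≡u)) = not-partner u u₀ (rest-sub u∈) u₀∈ (sym πu₀≡u)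
      partner-outside-rest (inj₂ (u , u∈ , inj₂ πu₀≡πu)) =
        rest-≢ u∈ (sym (partner-injective u₀ u u₀∈ (rest-sub u∈) πu₀≡πu))

      -- by minimality, the only neighbour of u₀ in Extended fs is π u₀
      u₀-pendant : ∀ r → With (Extended rest) u₀ (π u₀) r → Adj u₀ r → r ≡ π u₀
      u₀-pendant r Wr u₀r with neighbours u₀ u₀∈ r (merge r Wr) u₀r
      ... | inj₁ r≡πu₀ = r≡πu₀
      ... | inj₂ (u₂ , u₂∈ , _ , u₂<u₀) = ⊥-elim (<-irrefl refl (<-≤-trans u₂<u₀ (minimal u₂ u₂∈)))

      rest-peelable : Peelable rest
      rest-peelable = record
        { outside           = λ u → outside u ∘ rest-sub
        ; partner-outside   = λ u → partner-outside u ∘ rest-sub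
        ; not-partner       = λ u u₂ u∈ u₂∈ → not-partner u u₂ (rest-sub u∈) (rest-sub u₂∈)
        ; partner-injective = λ u u₂ u∈ u₂∈ → partner-injective u u₂ (rest-sub u∈) (rest-sub u₂∈)
        ; partner-adjacent  = λ u → partner-adjacent u ∘ rest-sub
        ; neighbours        = neighbours-rest
        }
        where
        neighbours-rest : ∀ u → u ∈ rest → ∀ r → Extended rest r → Adj u r →
                          r ≡ π u ⊎ Σ V λ u₂ → u₂ ∈ rest × r ≡ π u₂ × key u₂ < key u
        neighbours-rest u u∈ r Er ur with neighbours u (rest-sub u∈) r (extended-sub r Er) ur
        ... | inj₁ r≡πu = inj₁ r≡πu
        ... | inj₂ (u₂ , u₂∈ , r≡πu₂ , lt) with toSum (u₂ ≟V u₀)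
        ... | inj₁ refl = ⊥-elim (partner-outside-rest (subst (Extended rest) r≡πu₂ Er))
        ... | inj₂ u₂≢u₀ = inj₂ (u₂ , rest-intro u₂∈ u₂≢u₀ , r≡πu₂ , lt)

      step : Nonsing (Extended rest) ⇔ Nonsing (Extended fs)
      step = resp ⇔-∘ PendantPair.pendant-pair (Extended rest) u₀ (π u₀) u₀-outside partner-outside-rest
                        (not-partner u₀ u₀ u₀∈ u₀∈) (partner-adjacent u₀ u₀∈) u₀-pendant
        where
        resp : Nonsing (With (Extended rest) u₀ (π u₀)) ⇔ Nonsing (Extended fs)
        resp = mk⇔ (nonsing-resp merge split) (nonsing-resp split merge)

    peel : ∀ n fs → length fs ≤ n → Peelable fs → Nonsing X ⇔ Nonsing (Extended fs)
    peel _ [] _ _ = mk⇔ (nonsing-resp (λ _ → inj₁) only-X) (nonsing-resp only-X (λ _ → inj₁))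
      where
      only-X : ∀ r → Extended [] r → X r
      only-X r (inj₁ Xr) = Xr
    peel (suc n) (f ∷ fs) (s≤s |fs|≤n) peelable with min-by-key f fs
    ... | u₀ , u₀∈ , minimal = step ⇔-∘ peel n rest shorter rest-peelable
      where
      open RemoveMinimal peelable u₀ u₀∈ minimal
      shorter : length rest ≤ n
      shorter with rest-shorter
      ... | s≤s r = ≤-trans r |fs|≤n

module Expansion {n m : ℕ} (G : Graph n) (T : Graph m) (L : Fin n → Fin m) (x : Fin m)
    (U : Fin m → Fin m → Fin n → Bool) (P : Fin m → Fin m → Fin n → Fin n → Bool)
    (T-tree : IsTree T) where

  open RankExpansion G T L x U P
  open TreeSides T (proj₁ T-tree) (proj₂ T-tree)

  _≟H_ : DecidableEquality HV
  ⟨ a₁ , t₁ , h₁ , v₁ ⟩ ≟H ⟨ a₂ , t₂ , h₂ , v₂ ⟩ with a₁ ≟ a₂ | t₁ ≟ t₂ | h₁ ≟ h₂ | v₁ ≟ v₂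
  ... | yes refl | yes refl | yes refl | yes refl = yes refl
  ... | no ne | _ | _ | _ = no (ne ∘ cong elt)
  ... | _ | no ne | _ | _ = no (ne ∘ cong tl)
  ... | _ | _ | no ne | _ = no (ne ∘ cong hd)
  ... | _ | _ | _ | no ne = no (ne ∘ cong at)

  fromTuple : Fin n × Fin m × Fin m × Fin m → HV
  fromTuple (a , t , h , v) = ⟨ a , t , h , v ⟩

  fromTuple-injective : ∀ {p q} → fromTuple p ≡ fromTuple q → p ≡ q
  fromTuple-injective {_ , _ , _ , _} {_ , _ , _ , _} refl = refl

  allHV : List HV
  allHV = map fromTuple (cartesianProduct (allFin n) (cartesianProduct (allFin m) (cartesianProduct (allFin m) (allFin m))))

  allHV-unique : Unique allHV
  allHV-unique = Unique.map⁺ fromTuple-injective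
    (Unique.cartesianProduct⁺ (Unique.allFin⁺ n) (Unique.cartesianProduct⁺ (Unique.allFin⁺ m)
      (Unique.cartesianProduct⁺ (Unique.allFin⁺ m) (Unique.allFin⁺ m))))

  allHV-complete : ∀ q → q ∈ allHV
  allHV-complete q = ∈-map⁺ fromTuple (∈-cartesianProduct⁺ (∈-allFin (elt q))
    (∈-cartesianProduct⁺ (∈-allFin (tl q)) (∈-cartesianProduct⁺ (∈-allFin (hd q)) (∈-allFin (at q)))))

  arc? : ∀ t h → Dec (Arc t h)
  arc? t h = (adj T t h Bool.≟ true) ×-dec ¬? (same-side? t h x h)

  inner? : ∀ v → Dec (Inner T v)
  inner? v = ¬? (deg T v ℕ.≟ 1)

  Ends : HV → Set
  Ends q = at q ≡ tl q ⊎ at q ≡ hd q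

  ends? : ∀ q → Dec (Ends q)
  ends? q = (at q ≟ tl q) ⊎-dec (at q ≟ hd q)

  vertex? : ∀ q → Dec (VH q)
  vertex? q = arc? _ _ ×-dec ends? q ×-dec inner? (at q) ×-dec (U (tl q) (hd q) (elt q) Bool.≟ true)

  adjH? : ∀ q r → Dec (AdjH q r)
  adjH? q r = vertex? q ×-dec vertex? r ×-dec (adjA? ⊎-dec adjB? q r ⊎-dec adjB? r q ⊎-dec adjC?)
    where
    adjA? = (elt q ≟ elt r) ×-dec (tl q ≟ tl r) ×-dec (hd q ≟ hd r) ×-dec ¬? (at q ≟ at r)
            ×-dec inner? (tl q) ×-dec inner? (hd q)
    adjB? : ∀ q r → Dec (AdjB q r)
    adjB? q r = (at q ≟ hd q) ×-dec (at r ≟ tl r) ×-dec (at q ≟ at r) ×-dec (P (tl q) (hd q) (elt r) (elt q) Bool.≟ true)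
    adjC? = (at q ≟ tl q) ×-dec (at r ≟ tl r) ×-dec (at q ≟ at r) ×-dec ¬? (hd q ≟ hd r)
            ×-dec (adj G (elt q) (elt r) Bool.≟ true)

  adjH-sym : ∀ {q r} → AdjH q r → AdjH r q
  adjH-sym (vq , vr , inj₁ (e₁ , e₂ , e₃ , ne , i₁ , i₂)) =
    vr , vq , inj₁ (sym e₁ , sym e₂ , sym e₃ , ne ∘ sym , subst (Inner T) e₂ i₁ , subst (Inner T) e₃ i₂)
  adjH-sym (vq , vr , inj₂ (inj₁ qr)) = vr , vq , inj₂ (inj₂ (inj₁ qr))
  adjH-sym (vq , vr , inj₂ (inj₂ (inj₁ rq))) = vr , vq , inj₂ (inj₁ rq)
  adjH-sym (vq , vr , inj₂ (inj₂ (inj₂ (c₁ , c₂ , c₃ , c₄ , c₅)))) =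
    vr , vq , inj₂ (inj₂ (inj₂ (c₂ , c₁ , sym c₃ , c₄ ∘ sym , trans (adj-symmetric G _ _) c₅)))

  open KernelGraph _≟H_ allHV allHV-unique allHV-complete AdjH adjH? adjH-sym public

  other : HV → Fin m
  other q with at q ≟ tl q
  ... | yes _ = hd q
  ... | no _ = tl q

  partner : HV → HV
  partner q = ⟨ elt q , tl q , hd q , other q ⟩

  other-at-tail : ∀ q → at q ≡ tl q → other q ≡ hd q
  other-at-tail q e with at q ≟ tl q
  ... | yes _ = refl
  ... | no ne = ⊥-elim (ne e)

  other-at-head : ∀ q → at q ≡ hd q → tl q ≢ hd q → other q ≡ tl q
  other-at-head q e t≢h with at q ≟ tl q
  ... | yes e' = ⊥-elim (t≢h (trans (sym e') e))
  ... | no _ = refl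

  end-cases : ∀ q → Ends q → tl q ≢ hd q → (at q ≡ tl q × other q ≡ hd q) ⊎ (at q ≡ hd q × other q ≡ tl q)
  end-cases q (inj₁ e) _ = inj₁ (e , other-at-tail q e)
  end-cases q (inj₂ e) t≢h with toSum (at q ≟ tl q)
  ... | inj₁ e' = inj₁ (e' , other-at-tail q e')
  ... | inj₂ _ = inj₂ (e , other-at-head q e t≢h)

  partner-ends : ∀ q → Ends q → tl q ≢ hd q → Ends (partner q)
  partner-ends q en t≢h with end-cases q en t≢h
  ... | inj₁ (_ , o) = inj₂ o
  ... | inj₂ (_ , o) = inj₁ o

  at-≢-other : ∀ q → Ends q → tl q ≢ hd q → at q ≢ other q
  at-≢-other q en t≢h with end-cases q en t≢h
  ... | inj₁ (e , o) = λ e' → t≢h (trans (sym e) (trans e' o))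
  ... | inj₂ (e , o) = λ e' → t≢h (sym (trans (sym e) (trans e' o)))

  other-partner : ∀ q → Ends q → tl q ≢ hd q → other (partner q) ≡ at q
  other-partner q en t≢h with end-cases q en t≢h
  ... | inj₁ (e , o) = trans (other-at-head (partner q) o t≢h) (sym e)
  ... | inj₂ (e , o) = trans (other-at-tail (partner q) o) (sym e)

  partner-involutive : ∀ q → Ends q → tl q ≢ hd q → partner (partner q) ≡ q
  partner-involutive q en t≢h = cong (λ v → ⟨ elt q , tl q , hd q , v ⟩) (other-partner q en t≢h)

  edge-at : ∀ q → adj T (tl q) (hd q) ≡ true → Ends q → adj T (other q) (at q) ≡ true
  edge-at q th en with end-cases q en (adjacent-distinct T th)
  ... | inj₁ (e , o) = subst₂ (λ v w → adj T v w ≡ true) (sym o) (sym e) (trans (adj-symmetric T (hd q) (tl q)) th)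
  ... | inj₂ (e , o) = subst₂ (λ v w → adj T v w ≡ true) (sym o) (sym e) th

  adjacent-in-H : ∀ u r → AdjH u r → r ≡ partner u ⊎ (at r ≡ at u × other r ≢ other u)
  adjacent-in-H u r ((arc-u , ends-u , _) , (arc-r , ends-r , _) , inj₁ (e₁ , e₂ , e₃ , at≢ , _)) =
    inj₁ (same (sym e₁) (sym e₂) (sym e₃) (at-r (end-cases u ends-u (adjacent-distinct T (proj₁ arc-u))) ends-r))
    where
    same : ∀ {q r} → elt q ≡ elt r → tl q ≡ tl r → hd q ≡ hd r → at q ≡ at r → q ≡ r
    same {⟨ _ , _ , _ , _ ⟩} {⟨ _ , _ , _ , _ ⟩} refl refl refl refl = refl
    at-r : (at u ≡ tl u × other u ≡ hd u) ⊎ (at u ≡ hd u × other u ≡ tl u) → Ends r → at r ≡ other u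
    at-r (inj₁ (eu , o)) (inj₁ er) = ⊥-elim (at≢ (trans eu (trans e₂ (sym er))))
    at-r (inj₁ (eu , o)) (inj₂ er) = trans er (trans (sym e₃) (sym o))
    at-r (inj₂ (eu , o)) (inj₁ er) = trans er (trans (sym e₂) (sym o))
    at-r (inj₂ (eu , o)) (inj₂ er) = ⊥-elim (at≢ (trans eu (trans e₃ (sym er))))
  adjacent-in-H u r ((arc-u , _) , (arc-r , _) , inj₂ (inj₁ (b₁ , b₂ , b₃ , _))) =
    inj₂ (sym b₃ , λ o → orientation-unique x (tl u) (hd u) (proj₂ arc-u)
      (subst₂ (λ t h → ¬ Reach (cut t h) x h) (trans (sym b₂) (trans (sym b₃) b₁))
        (trans (sym (other-at-tail r b₂)) (trans o (other-at-head u b₁ (adjacent-distinct T (proj₁ arc-u))))) (proj₂ arc-r)))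
  adjacent-in-H u r ((arc-u , _) , (arc-r , _) , inj₂ (inj₂ (inj₁ (b₁ , b₂ , b₃ , _)))) =
    inj₂ (b₃ , λ o → orientation-unique x (tl u) (hd u) (proj₂ arc-u)
      (subst₂ (λ t h → ¬ Reach (cut t h) x h) (trans (sym (other-at-head r b₁ (adjacent-distinct T (proj₁ arc-r)))) (trans o (other-at-tail u b₂)))
        (trans (sym b₁) (trans b₃ b₂)) (proj₂ arc-r)))
  adjacent-in-H u r (_ , _ , inj₂ (inj₂ (inj₂ (c₁ , c₂ , c₃ , hd≢ , _)))) =
    inj₂ (sym c₃ , λ o → hd≢ (trans (sym (other-at-tail u c₁)) (trans (sym o) (other-at-tail r c₂))))

  module AlongPath (leaf-L : ∀ c → Leaf T (L c)) (L-injective : ∀ c d → L c ≡ L d → c ≡ d)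
      (a b : Fin n) (a≢b : a ≢ b) (ps : List (Fin m)) (path : IsPath T (L a) (L b) ps) where

    s : Fin m
    s = L a

    open FarSides s

    OnPath : Fin m → Fin m → Set
    OnPath t h = Consec ps t h ⊎ Consec ps h t

    onPath? : ∀ t h → Dec (OnPath t h)
    onPath? t h = consec? ps t h ⊎-dec consec? ps h t

    OnPath-flip : ∀ {t h} → OnPath t h → OnPath h t
    OnPath-flip (inj₁ c) = inj₂ c
    OnPath-flip (inj₂ c) = inj₁ c

    OffPath : HV → Set
    OffPath q = Arc (tl q) (hd q) × Inner T (tl q) × Inner T (hd q) × ¬ OnPath (tl q) (hd q) × Ends q
                × U (tl q) (hd q) (elt q) ≡ true

    NearEnd : HV → Set
    NearEnd q = Reach (cut (other q) (at q)) s (at q)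

    Far Near : HV → Set
    Far q = OffPath q × ¬ NearEnd q
    Near q = OffPath q × NearEnd q

    far? : ∀ q → Dec (Far q)
    far? q = (arc? _ _ ×-dec inner? _ ×-dec inner? _ ×-dec ¬? (onPath? _ _) ×-dec ends? q
               ×-dec (U (tl q) (hd q) (elt q) Bool.≟ true))
             ×-dec ¬? (same-side? (other q) (at q) s (at q))

    key : HV → ℕ
    key q = farSize (other q) (at q)

    offPath-distinct : ∀ {q} → OffPath q → tl q ≢ hd q
    offPath-distinct off = adjacent-distinct T (proj₁ (proj₁ off))

    offPath-ends : ∀ {q} → OffPath q → Ends q
    offPath-ends (_ , _ , _ , _ , en , _) = en

    offPath-partner : ∀ q → OffPath q → OffPath (partner q)
    offPath-partner q off@(arc , it , ih , ¬on , en , uq) = arc , it , ih , ¬on , partner-ends q en (offPath-distinct off) , uq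

    offPath-vertex : ∀ q → OffPath q → VH q
    offPath-vertex q (arc , it , ih , _ , inj₁ e , uq) = arc , inj₁ e , subst (Inner T) (sym e) it , uq
    offPath-vertex q (arc , it , ih , _ , inj₂ e , uq) = arc , inj₂ e , subst (Inner T) (sym e) ih , uq

    far-partner-near : ∀ u → Far u → Near (partner u)
    far-partner-near u (off , far) = offPath-partner u off , subst (λ v → Reach (cut v (other u)) s (other u))
      (sym (other-partner u (offPath-ends off) (offPath-distinct off))) (reach-ext (cut-swap (adj T) _ _) s-near-other)
      where
      s-near-other : Reach (cut (other u) (at u)) s (other u)
      s-near-other with side (other u) (at u) s
      ... | inj₁ r = r
      ... | inj₂ r = ⊥-elim (far r)

    near-partner-far : ∀ r → Near r → Far (partner r)
    near-partner-far r (off , near) = offPath-partner r off , λ near' →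
      sides-disjoint (edge-at r (proj₁ (proj₁ off)) (offPath-ends off))
        (reach-ext (cut-swap (adj T) _ _)
          (subst (λ v → Reach (cut v (other r)) s (other r)) (other-partner r (offPath-ends off) (offPath-distinct off)) near'))
        near

    -- the path survives the deletion of an edge off the path, so its vertices stay near s
    path-near : ∀ q → OffPath q → ∀ {w} → w ∈ ps → Reach (cut (other q) (at q)) s w
    path-near q off w∈ = walk-reaches (walk-avoiding (other q) (at q) (proj₁ path) (¬on ∘ inj₁) (¬on ∘ inj₂)) w∈
      where
      ¬on : ¬ OnPath (other q) (at q)
      ¬on on with end-cases q (offPath-ends off) (offPath-distinct off)
      ... | inj₁ (e , o) = proj₁ (proj₂ (proj₂ (proj₂ off))) (subst₂ OnPath e o (OnPath-flip on))
      ... | inj₂ (e , o) = proj₁ (proj₂ (proj₂ (proj₂ off))) (subst₂ OnPath o e on)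

    edgeBar-edge : ∀ {t h q} → EdgeBar t h q → tl q ≡ t × hd q ≡ h
    edgeBar-edge (inj₁ (_ , _ , e₁ , e₂ , _)) = e₁ , e₂
    edgeBar-edge (inj₂ (_ , _ , e₁ , e₂ , _)) = e₁ , e₂

    offPath-not-XP : ∀ q → OffPath q → ¬ XP ps q
    offPath-not-XP q (_ , _ , _ , ¬on , _) (t , h , _ , on , eb) with edgeBar-edge eb
    ... | refl , refl = ¬on on

    end-on-path : ∀ {t h z} → (z ≡ t ⊎ z ≡ h) → OnPath t h → z ∈ ps
    end-on-path (inj₁ refl) (inj₁ c) = proj₁ (consec-mem c)
    end-on-path (inj₁ refl) (inj₂ c) = proj₂ (consec-mem c)
    end-on-path (inj₂ refl) (inj₁ c) = proj₂ (consec-mem c)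
    end-on-path (inj₂ refl) (inj₂ c) = proj₁ (consec-mem c)

    XP-on-path : ∀ q → XP ps q → Ends q → at q ∈ ps
    XP-on-path q (t , h , _ , on , eb) en with edgeBar-edge eb
    ... | refl , refl = end-on-path en on

    leaf-edge-on-path : ∀ {ℓ y t h} → Leaf T ℓ → adj T ℓ y ≡ true → OnPath ℓ y → adj T t h ≡ true →
      (t ≡ ℓ ⊎ h ≡ ℓ) → OnPath t h
    leaf-edge-on-path leaf ℓy on th (inj₁ refl) with leaf-neighbour-unique T leaf th ℓy
    ... | refl = on
    leaf-edge-on-path leaf ℓy on th (inj₂ refl) with leaf-neighbour-unique T leaf (trans (adj-symmetric T _ _) th) ℓy
    ... | refl = OnPath-flip on

    bar-on-path : ∀ c {y} → adj T (L c) y ≡ true → OnPath (L c) y → ∀ q → Bar c q → XP ps q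
    bar-on-path c cy on q bar@(arc , end , _) =
      tl q , hd q , arc , leaf-edge-on-path (leaf-L c) cy on (proj₁ arc) end , inj₂ (c , end , refl , refl , bar)

    La≢Lb : L a ≢ L b
    La≢Lb = a≢b ∘ L-injective a b

    bar-a-on-path : ∀ q → Bar a q → XP ps q
    bar-a-on-path with first-edge (proj₁ path) La≢Lb
    ... | _ , c , e = bar-on-path a e (inj₁ c)

    bar-b-on-path : ∀ q → Bar b q → XP ps q
    bar-b-on-path with last-edge (proj₁ path) La≢Lb
    ... | _ , c , e = bar-on-path b (trans (adj-symmetric T _ _) e) (inj₂ c)

    classify : ∀ q → XI a b q → XP ps q ⊎ Far q ⊎ Near q
    classify q (inj₁ (t , h , _ , it , _ , inj₂ (c , inj₁ t≡Lc , _))) = ⊥-elim (it (subst (Leaf T) (sym t≡Lc) (leaf-L c)))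
    classify q (inj₁ (t , h , _ , _ , ih , inj₂ (c , inj₂ h≡Lc , _))) = ⊥-elim (ih (subst (Leaf T) (sym h≡Lc) (leaf-L c)))
    classify q (inj₁ (_ , _ , arc , it , ih , eb@(inj₁ (_ , _ , refl , refl , en , uq)))) with onPath? (tl q) (hd q)
    ... | yes on = inj₁ (tl q , hd q , arc , on , eb)
    ... | no ¬on with same-side? (other q) (at q) s (at q)
    ... | yes near = inj₂ (inj₂ ((arc , it , ih , ¬on , en , uq) , near))
    ... | no far = inj₂ (inj₁ ((arc , it , ih , ¬on , en , uq) , far))
    classify q (inj₂ (inj₁ bar)) = inj₁ (bar-a-on-path q bar)
    classify q (inj₂ (inj₂ bar)) = inj₁ (bar-b-on-path q bar)

    offPath-XI : ∀ q → OffPath q → XI a b q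
    offPath-XI q (arc , it , ih , _ , en , uq) = inj₁ (tl q , hd q , arc , it , ih , inj₁ (it , ih , refl , refl , en , uq))

    -- a leaf on the path is one of its ends, so X_P ⊆ X_I
    XP-XI : ∀ q → XP ps q → XI a b q
    XP-XI q (t , h , arc , _ , inj₁ eb@(it , ih , _)) = inj₁ (t , h , arc , it , ih , inj₁ eb)
    XP-XI q (_ , _ , _ , on , inj₂ (c , end , refl , refl , bar)) with L c ≟ L a | L c ≟ L b
    ... | yes e | _ = inj₂ (inj₁ (subst (λ d → Bar d q) (L-injective c a e) bar))
    ... | no _ | yes e = inj₂ (inj₂ (subst (λ d → Bar d q) (L-injective c b e) bar))
    ... | no ≢a | no ≢b with path-interior (proj₁ path) (proj₂ path) (end-on-path (Data.Sum.map sym sym end) on) ≢a ≢b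
    ... | p , p' , p≢p' , e , e' with subst (2 ≤_) (leaf-L c) (count-two (adj T (L c)) p p' (trans (adj-symmetric T _ _) e) e' p≢p')
    ... | s≤s ()

    -- Let u be a far copy, at the vertex w of its edge vw.  A
    -- neighbour r of u in X_I other than its partner sits at w on another edge wy; w is then
    -- on the near side of wy, so r is a near copy, the partner of the far copy at y, and
    -- the far side of wy is strictly smaller than that of vw.
    far-neighbours : ∀ u → Far u → ∀ r → XI a b r → AdjH u r →
      r ≡ partner u ⊎ Σ HV λ u₂ → Far u₂ × r ≡ partner u₂ × key u₂ < key u
    far-neighbours u (off-u , far-u) r r∈XI ur with adjacent-in-H u r ur
    ... | inj₁ r≡πu = inj₁ r≡πu
    ... | inj₂ (same-at , y≢v) = by-class (classify r r∈XI)
      where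
      arc-r = proj₁ (proj₁ (proj₂ ur))
      ends-r = proj₁ (proj₂ (proj₁ (proj₂ ur)))
      vw : adj T (other u) (at u) ≡ true
      vw = edge-at u (proj₁ (proj₁ off-u)) (offPath-ends off-u)
      wy : adj T (at u) (other r) ≡ true
      wy = subst (λ w → adj T w (other r) ≡ true) same-at
             (trans (adj-symmetric T _ _) (edge-at r (proj₁ arc-r) ends-r))
      away = step-away vw wy y≢v far-u
      r-near : NearEnd r
      r-near = subst (λ w → Reach (cut (other r) w) s w) (sym same-at) (reach-ext (cut-swap (adj T) _ _) (proj₁ away))
      shrinks : key (partner r) < key u
      shrinks = subst (λ w → farSize w (other r) < key u)
        (sym (trans (other-partner r ends-r (adjacent-distinct T (proj₁ arc-r))) same-at))
        (far-shrinks vw wy y≢v far-u)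
      by-class : XP ps r ⊎ Far r ⊎ Near r → r ≡ partner u ⊎ Σ HV λ u₂ → Far u₂ × r ≡ partner u₂ × key u₂ < key u
      by-class (inj₁ r∈XP) = ⊥-elim (far-u (path-near u off-u (subst (_∈ ps) same-at (XP-on-path r r∈XP ends-r))))
      by-class (inj₂ (inj₁ (_ , r-far))) = ⊥-elim (r-far r-near)
      by-class (inj₂ (inj₂ near)) =
        inj₂ (partner r , near-partner-far r near , sym (partner-involutive r ends-r (adjacent-distinct T (proj₁ arc-r))) , shrinks)

    -- X_I is X_P with the pairs {u , partner u}, u far, added
    farList : List HV
    farList = filter far? allHV

    farList-sound : ∀ {u} → u ∈ farList → Far u
    farList-sound u∈ = proj₂ (∈-filter⁻ far? {xs = allHV} u∈)

    farList-complete : ∀ {u} → Far u → u ∈ farList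
    farList-complete {u} far = ∈-filter⁺ far? (allHV-complete u) far

    open Peeling (XP ps) partner key

    Extended-XI : ∀ r → Extended farList r → XI a b r
    Extended-XI r (inj₁ r∈XP) = XP-XI r r∈XP
    Extended-XI r (inj₂ (u , u∈ , inj₁ refl)) = offPath-XI u (proj₁ (farList-sound u∈))
    Extended-XI r (inj₂ (u , u∈ , inj₂ refl)) = offPath-XI (partner u) (proj₁ (far-partner-near u (farList-sound u∈)))

    XI-Extended : ∀ r → XI a b r → Extended farList r
    XI-Extended r r∈XI with classify r r∈XI
    ... | inj₁ r∈XP = inj₁ r∈XP
    ... | inj₂ (inj₁ far) = inj₂ (r , farList-complete far , inj₁ refl)
    ... | inj₂ (inj₂ near@(off , _)) = inj₂ (partner r , farList-complete (near-partner-far r near) ,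
                                         inj₂ (sym (partner-involutive r (offPath-ends off) (offPath-distinct off))))

    farList-peelable : Peelable farList
    farList-peelable = record
      { outside           = λ u → offPath-not-XP u ∘ proj₁ ∘ farList-sound
      ; partner-outside   = λ u → offPath-not-XP (partner u) ∘ proj₁ ∘ far-partner-near u ∘ farList-sound
      ; not-partner       = λ u u₂ u∈ u₂∈ u≡πu₂ →
          proj₂ (farList-sound u∈) (proj₂ (subst Near (sym u≡πu₂) (far-partner-near u₂ (farList-sound u₂∈))))
      ; partner-injective = λ u u₂ u∈ u₂∈ πu≡πu₂ →
          let off = proj₁ (farList-sound u∈) ; off₂ = proj₁ (farList-sound u₂∈) in
          trans (sym (partner-involutive u (offPath-ends off) (offPath-distinct off)))
                (trans (cong partner πu≡πu₂) (partner-involutive u₂ (offPath-ends off₂) (offPath-distinct off₂)))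
      ; partner-adjacent  = λ u u∈ → partner-adjacent u (proj₁ (farList-sound u∈))
      ; neighbours        = λ u u∈ r r∈ ur → in-list (far-neighbours u (farList-sound u∈) r (Extended-XI r r∈) ur)
      }
      where
      partner-adjacent : ∀ u → OffPath u → AdjH u (partner u)
      partner-adjacent u off@(_ , it , ih , _) = offPath-vertex u off , offPath-vertex (partner u) (offPath-partner u off) ,
        inj₁ (refl , refl , refl , at-≢-other u (offPath-ends off) (offPath-distinct off) , it , ih)
      in-list : ∀ {u r} → r ≡ partner u ⊎ (Σ HV λ u₂ → Far u₂ × r ≡ partner u₂ × key u₂ < key u) →
                r ≡ partner u ⊎ (Σ HV λ u₂ → u₂ ∈ farList × r ≡ partner u₂ × key u₂ < key u)
      in-list (inj₁ e) = inj₁ e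
      in-list (inj₂ (u₂ , far , e , lt)) = inj₂ (u₂ , farList-complete far , e , lt)

    XI⇔XP : Nonsingular (XI a b) ⇔ Nonsingular (XP ps)
    XI⇔XP = mk⇔ (Equivalence.from peeled ∘ nonsing-resp XI-Extended Extended-XI)
                (nonsing-resp Extended-XI XI-Extended ∘ Equivalence.to peeled)
      where
      peeled : Nonsing (XP ps) ⇔ Nonsing (Extended farList)
      peeled = peel (length farList) farList ≤-refl farList-peelable

lemma3p6 : ∀ {n m : ℕ} (G : Graph n) (T : Graph m) (L : Fin n → Fin m) (x : Fin m)
    (U : Fin m → Fin m → Fin n → Bool) (P : Fin m → Fin m → Fin n → Fin n → Bool) →
    Connected G → 3 ≤ n → IsRankDecomposition G T L → Leaf T x →
    RankExpansion.ValidU G T L x U P → RankExpansion.ValidP G T L x U P →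
    (a b : Fin n) → a ≢ b → (ps : List (Fin m)) → IsPath T (L a) (L b) ps →
    (RankExpansion.Nonsingular G T L x U P (RankExpansion.XI G T L x U P a b)
    ⇔ RankExpansion.Nonsingular G T L x U P (RankExpansion.XP G T L x U P ps))
lemma3p6 G T L x U P _ _ (subcubic , leaf-L , L-injective , _) _ _ _ a b a≢b ps path =
  Expansion.AlongPath.XI⇔XP G T L x U P (proj₁ subcubic) leaf-L L-injective a b a≢b ps path
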